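{- Let $R$ be a commutative ring with $1$, $p$ a prime, and $\sigma:R\to R$ a ring endomorphism with $\sigma(a)\equiv a^p\bmod pR$ for all $a\in R$. For $a\in R$ define $\delta_s=\delta_s(a)\in R$, $s=1,2,\dots$, recursively by $$a^{p^s-1}=\delta_1(a)\,\sigma(a^{p^{s-1}-1})+\delta_2(a)\,\sigma^2(a^{p^{s-2}-1})+\dots+\delta_s(a),$$ i.e. $a^{p^s-1}=\sum_{i=1}^s\delta_i(a)\,\sigma^i(a^{p^{s-i}-1})$. Then (i) $\delta_s(a)\in p^{s-1}R$ for every $s\ge1$; (ii) $a^{mp^s-1}-\sum_{i=1}^s\delta_i(a)\,\sigma^i(a^{mp^{s-i}-1})\in p^sR$ for all $m,s\ge1$. -}

module Defs where

open import Level using (_⊔_)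
open import Algebra.Bundles using (CommutativeRing; Semiring)
open import Data.Nat.Base as ℕ using (ℕ; zero; suc; _∸_; _≤ᵇ_)
open import Data.Bool.Base using (if_then_else_)
open import Data.Product.Base using (∃)

module RingDefs {c ℓ} (R : CommutativeRing c ℓ) where
  open CommutativeRing R
  open import Algebra.Definitions.RawSemiring (Semiring.rawSemiring semiring) using (_^_; _×_)

  pow : Carrier → ℕ → Carrier
  pow = _^_

  InMultiples : ℕ → Carrier → Set (c ⊔ ℓ)
  InMultiples n x = ∃ λ r → x ≈ (n × 1#) * r

  iter : (Carrier → Carrier) → ℕ → Carrier → Carrier
  iter σ zero    x = x
  iter σ (suc i) x = σ (iter σ i x)

  sum1 : ℕ → (ℕ → Carrier) → Carrier
  sum1 zero    f = 0#
  sum1 (suc s) f = sum1 s f + f (suc s)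

  -- Since σ^s(a^0) = σ^s(1), we solve for δ_s as
  --   δ_s = a^(p^s - 1) - Σ_{i=1}^{s-1} δ_i σ^i(a^(p^(s-i) - 1)).
  -- deltaTable n i = δ_i(a) for 1 ≤ i ≤ n (and 0# at i = 0 and for i > n).
  deltaTable : ℕ → ℕ → (Carrier → Carrier) → Carrier → ℕ → Carrier
  deltaTable zero    p σ a i = 0#
  deltaTable (suc n) p σ a i =
    if i ≤ᵇ n then deltaTable n p σ a i
    else (a ^ (p ℕ.^ suc n ∸ 1)
          - sum1 n (λ j → deltaTable n p σ a j * iter σ j (a ^ (p ℕ.^ (suc n ∸ j) ∸ 1))))
  δ : ℕ → (Carrier → Carrier) → Carrier → ℕ → Carrier
  δ p σ a s = deltaTable s p σ a s

open RingDefs public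

{-# OPTIONS --safe #-}
-- Write x ≈ y mod d for x − y ∈ dR. From σ x ≈ x^p mod p, raising to the power p^k
-- (each p-th power gains one factor of p) gives σ(x^(p^k)) ≈ x^(p^(k+1)) mod p^(k+1), and
-- iterating, σ^i(x^(p^k)) ≈ x^(p^(i+k)) mod p^(k+1). Factor a^(m q − 1) = a^(q − 1) · X^q with
-- X = a^(m−1) and q = p^(s−i). If δ_i ∈ p^(i−1)R for i ≤ s, then modulo p^(i−1) · p^(s−i+1) = p^s
-- each term δ_i σ^i(a^(m p^(s−i) − 1)) may be replaced by δ_i σ^i(a^(p^(s−i) − 1)) · X^(p^s), and by
-- the defining recursion these sum to a^(p^s − 1) · X^(p^s) = a^(m p^s − 1). This is (ii) for s; its
-- case m = p says δ_(s+1) ∈ p^s R, so (i) follows by strong induction on s.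

module Submission where

open import Defs
open import Algebra.Bundles using (CommutativeRing; Semiring)
open import Algebra.Morphism.Structures using (module RingMorphisms)
import Algebra.Morphism.Construct.Composition as Composition
import Algebra.Morphism.Construct.Identity as Identity
open import Data.Nat.Base as ℕ using (ℕ; zero; suc; z≤n; s≤s; _≤_; _<_; _∸_; _≤ᵇ_; NonZero) renaming (_^_ to _^ℕ_)
import Data.Nat.Properties as ℕ
open import Data.Nat.Induction using (<-rec)
open import Data.Nat.Primality using (Prime; prime⇒nonZero)
open import Data.Bool.Base using (true; false)
open import Data.Empty using (⊥-elim)
open import Data.Product.Base using (_,_; ∃)
open import Data.Sum.Base using (inj₁; inj₂)
open import Function.Base using (_∘_)
open import Level using (_⊔_)
open import Relation.Binary.PropositionalEquality as ≡ using (_≡_)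

module Congruences {c ℓ} (R : CommutativeRing c ℓ) where
  open CommutativeRing R
  open import Algebra.Definitions.RawSemiring (Semiring.rawSemiring semiring) using (_^_; _×_)
  open import Algebra.Properties.Semiring.Exp semiring using (^-congˡ; ^-homo-*; ^-assocʳ)
  open import Algebra.Solver.Ring.NaturalCoefficients.Default commutativeSemiring
  open import Relation.Binary.Reasoning.Setoid setoid

  infix 4 _∣_ _≈_mod_

  _∣_ : Carrier → Carrier → Set (c ⊔ ℓ)
  d ∣ x = ∃ λ r → x ≈ d * r

  _≈_mod_ : Carrier → Carrier → Carrier → Set (c ⊔ ℓ)
  _≈_mod_ x y d = ∃ λ r → x ≈ y + d * r

  ∣-reflexive : ∀ {d e} → d ≈ e → d ∣ e
  ∣-reflexive {d} d≈e = 1# , trans (sym d≈e) (sym (*-identityʳ d))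

  ∣-respʳ : ∀ {d x y} → x ≈ y → d ∣ x → d ∣ y
  ∣-respʳ x≈y (r , x≈dr) = r , trans (sym x≈y) x≈dr

  1∣_ : ∀ x → 1 × 1# ∣ x
  1∣ x = x , solve 1 (λ x → x := (con 1 :+ con 0) :* x) refl x

  ≈⇒≈-mod : ∀ {d x y} → x ≈ y → x ≈ y mod d
  ≈⇒≈-mod {d} {x} {y} x≈y = 0# , (begin
    x              ≈⟨ x≈y ⟩
    y              ≈⟨ solve 2 (λ y d → y := y :+ d :* con 0) refl y d ⟩
    y + d * 0#     ∎)

  mod-sym : ∀ {d x y} → x ≈ y mod d → y ≈ x mod d
  mod-sym {d} {x} {y} (r , x≈y+dr) = - r , sym (begin
    x + d * - r           ≈⟨ +-congʳ x≈y+dr ⟩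
    y + d * r + d * - r   ≈⟨ +-assoc y (d * r) (d * - r) ⟩
    y + (d * r + d * - r) ≈⟨ +-congˡ (distribˡ d r (- r)) ⟨
    y + d * (r - r)       ≈⟨ +-congˡ (*-congˡ (-‿inverseʳ r)) ⟩
    y + d * 0#            ≈⟨ +-congˡ (zeroʳ d) ⟩
    y + 0#                ≈⟨ +-identityʳ y ⟩
    y                     ∎)

  mod-trans : ∀ {d x y z} → x ≈ y mod d → y ≈ z mod d → x ≈ z mod d
  mod-trans {d} {x} {y} {z} (r , x≈y+dr) (s , y≈z+ds) = s + r , (begin
    x                 ≈⟨ x≈y+dr ⟩
    y + d * r         ≈⟨ +-congʳ y≈z+ds ⟩
    z + d * s + d * r ≈⟨ solve 4 (λ z d s r → z :+ d :* s :+ d :* r := z :+ d :* (s :+ r)) refl z d s r ⟩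
    z + d * (s + r)   ∎)

  mod-+-cong : ∀ {d x x′ y y′} → x ≈ x′ mod d → y ≈ y′ mod d → x + y ≈ x′ + y′ mod d
  mod-+-cong {d} {x} {x′} {y} {y′} (r , x≈) (s , y≈) = r + s , (begin
    x + y                     ≈⟨ +-cong x≈ y≈ ⟩
    x′ + d * r + (y′ + d * s) ≈⟨ solve 5 (λ x′ y′ d r s → x′ :+ d :* r :+ (y′ :+ d :* s) := x′ :+ y′ :+ d :* (r :+ s)) refl x′ y′ d r s ⟩
    x′ + y′ + d * (r + s)     ∎)

  mod-*-cong : ∀ {d x x′ y y′} → x ≈ x′ mod d → y ≈ y′ mod d → x * y ≈ x′ * y′ mod d
  mod-*-cong {d} {x} {x′} {y} {y′} (r , x≈) (s , y≈) = x′ * s + r * y′ + d * r * s , (begin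
    x * y                          ≈⟨ *-cong x≈ y≈ ⟩
    (x′ + d * r) * (y′ + d * s)    ≈⟨ solve 5 (λ x′ y′ d r s → (x′ :+ d :* r) :* (y′ :+ d :* s) := x′ :* y′ :+ d :* (x′ :* s :+ r :* y′ :+ d :* r :* s)) refl x′ y′ d r s ⟩
    x′ * y′ + d * (x′ * s + r * y′ + d * r * s) ∎)

  mod-weaken : ∀ {d e x y} → d ∣ e → x ≈ y mod e → x ≈ y mod d
  mod-weaken {d} {e} {x} {y} (u , e≈du) (r , x≈y+er) = u * r , (begin
    x               ≈⟨ x≈y+er ⟩
    y + e * r       ≈⟨ +-congˡ (*-congʳ e≈du) ⟩
    y + d * u * r   ≈⟨ +-congˡ (*-assoc d u r) ⟩
    y + d * (u * r) ∎)

  mod-*-scale : ∀ {d e t x y} → e ∣ t → x ≈ y mod d → t * x ≈ t * y mod e * d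
  mod-*-scale {d} {e} {t} {x} {y} (u , t≈eu) (r , x≈y+dr) = u * r , (begin
    t * x                       ≈⟨ *-cong t≈eu x≈y+dr ⟩
    e * u * (y + d * r)         ≈⟨ solve 5 (λ e u y d r → e :* u :* (y :+ d :* r) := e :* u :* y :+ e :* d :* (u :* r)) refl e u y d r ⟩
    e * u * y + e * d * (u * r) ≈⟨ +-congʳ (*-congʳ t≈eu) ⟨
    t * y + e * d * (u * r)     ∎)

  mod⇒∣- : ∀ {d x y} → x ≈ y mod d → d ∣ x - y
  mod⇒∣- {d} {x} {y} (r , x≈y+dr) = r , (begin
    x - y             ≈⟨ +-congʳ x≈y+dr ⟩
    y + d * r - y     ≈⟨ +-congʳ (+-comm y (d * r)) ⟩
    d * r + y - y     ≈⟨ +-assoc (d * r) y (- y) ⟩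
    d * r + (y - y)   ≈⟨ +-congˡ (-‿inverseʳ y) ⟩
    d * r + 0#        ≈⟨ +-identityʳ (d * r) ⟩
    d * r             ∎)

  ∣-⇒mod : ∀ {d x y} → d ∣ x - y → x ≈ y mod d
  ∣-⇒mod {d} {x} {y} (r , x-y≈dr) = r , (begin
    x                 ≈⟨ +-identityʳ x ⟨
    x + 0#            ≈⟨ +-congˡ (-‿inverseˡ y) ⟨
    x + (- y + y)     ≈⟨ +-assoc x (- y) y ⟨
    x - y + y         ≈⟨ +-congʳ x-y≈dr ⟩
    d * r + y         ≈⟨ +-comm (d * r) y ⟩
    y + d * r         ∎)

  sum1-cong : ∀ n {f g} → (∀ {i} → i < n → f (suc i) ≈ g (suc i)) → sum1 R n f ≈ sum1 R n g
  sum1-cong zero    f≈g = refl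
  sum1-cong (suc n) f≈g = +-cong (sum1-cong n (λ i<n → f≈g (ℕ.m<n⇒m<1+n i<n))) (f≈g (ℕ.n<1+n n))

  sum1-cong-mod : ∀ n {d f g} → (∀ {i} → i < n → f (suc i) ≈ g (suc i) mod d) →
                  sum1 R n f ≈ sum1 R n g mod d
  sum1-cong-mod zero    f≈g = ≈⇒≈-mod refl
  sum1-cong-mod (suc n) f≈g =
    mod-+-cong (sum1-cong-mod n (λ i<n → f≈g (ℕ.m<n⇒m<1+n i<n))) (f≈g (ℕ.n<1+n n))

  sum1-*-distribʳ : ∀ n f x → sum1 R n f * x ≈ sum1 R n (λ i → f i * x)
  sum1-*-distribʳ zero    f x = zeroˡ x
  sum1-*-distribʳ (suc n) f x = trans (distribʳ x (sum1 R n f) (f (suc n))) (+-congʳ (sum1-*-distribʳ n f x))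

  ^-suc-mod-square : ∀ y e n → (y + e) ^ suc n ≈ y ^ suc n + (suc n × 1#) * (e * y ^ n) mod e * e
  ^-suc-mod-square y e zero = ≈⇒≈-mod (solve 2 (λ y e → (y :+ e) :* con 1 := y :* con 1 :+ (con 1 :+ con 0) :* (e :* con 1)) refl y e)
  ^-suc-mod-square y e (suc n) =
    mod-trans (mod-*-cong (≈⇒≈-mod refl) (^-suc-mod-square y e n))
              (N * y ^ n , solve 4 (λ y e z N → (y :+ e) :* (y :* z :+ N :* (e :* z))
                                   := y :* (y :* z) :+ (con 1 :+ N) :* (e :* (y :* z)) :+ e :* e :* (N :* z)) refl y e (y ^ n) N)
    where N = suc n × 1#

  ^-lift : ∀ n {q x y} → x ≈ y mod (n × 1#) * q → x ^ n ≈ y ^ n mod (n × 1#) * ((n × 1#) * q)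
  ^-lift zero    _ = ≈⇒≈-mod refl
  ^-lift (suc n) {q} {x} {y} (r , x≈y+e) =
    mod-trans (mod-trans (≈⇒≈-mod (^-congˡ (suc n) x≈y+e))
                         (mod-weaken e*e-divisible (^-suc-mod-square y e n)))
              (r * y ^ n , solve 5 (λ y z N q r → y :+ N :* (N :* q :* r :* z) := y :+ N :* (N :* q) :* (r :* z)) refl (y ^ suc n) (y ^ n) N q r)
    where
    N = suc n × 1#
    e = N * q * r
    e*e-divisible : N * (N * q) ∣ e * e
    e*e-divisible = q * r * r , solve 3 (λ N q r → N :* q :* r :* (N :* q :* r) := N :* (N :* q) :* (q :* r :* r)) refl N q r

  ^-split : ∀ x {m q} → 1 ≤ m → 1 ≤ q → x ^ (m ℕ.* q ∸ 1) ≈ x ^ (q ∸ 1) * (x ^ (m ∸ 1)) ^ q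
  ^-split x {suc m} {q} _ 1≤q = begin
    x ^ (q ℕ.+ m ℕ.* q ∸ 1)      ≡⟨ ≡.cong (x ^_) (ℕ.+-∸-comm (m ℕ.* q) 1≤q) ⟩
    x ^ (q ∸ 1 ℕ.+ m ℕ.* q)      ≈⟨ ^-homo-* x (q ∸ 1) (m ℕ.* q) ⟩
    x ^ (q ∸ 1) * x ^ (m ℕ.* q)  ≈⟨ *-congˡ (^-assocʳ x m q) ⟨
    x ^ (q ∸ 1) * (x ^ m) ^ q    ∎

module Endomorphisms {c ℓ} (R : CommutativeRing c ℓ) where
  open CommutativeRing R
  open RingMorphisms rawRing rawRing using (IsRingHomomorphism)
  open import Algebra.Definitions.RawSemiring (Semiring.rawSemiring semiring) using (_^_; _×_)
  open Congruences R

  iter-isRingHomomorphism : ∀ {σ} → IsRingHomomorphism σ → ∀ i → IsRingHomomorphism (iter R σ i)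
  iter-isRingHomomorphism σ-hom zero    = Identity.isRingHomomorphism rawRing refl
  iter-isRingHomomorphism σ-hom (suc i) = Composition.isRingHomomorphism trans (iter-isRingHomomorphism σ-hom i) σ-hom

  module _ {φ} (φ-hom : IsRingHomomorphism φ) where
    open IsRingHomomorphism φ-hom

    ×1-homo : ∀ n → φ (n × 1#) ≈ n × 1#
    ×1-homo zero    = 0#-homo
    ×1-homo (suc n) = trans (+-homo 1# (n × 1#)) (+-cong 1#-homo (×1-homo n))

    ^-homo : ∀ x n → φ (x ^ n) ≈ φ x ^ n
    ^-homo x zero    = 1#-homo
    ^-homo x (suc n) = trans (*-homo x (x ^ n)) (*-congˡ (^-homo x n))

    mod-homo : ∀ {d x y} → x ≈ y mod d → φ x ≈ φ y mod φ d
    mod-homo {d} {x} {y} (r , x≈y+dr) = φ r , trans (⟦⟧-cong x≈y+dr) (trans (+-homo y (d * r)) (+-congˡ (*-homo d r)))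

module DeltaTable {c ℓ} (R : CommutativeRing c ℓ) (p : ℕ)
  (σ : CommutativeRing.Carrier R → CommutativeRing.Carrier R) (a : CommutativeRing.Carrier R) where
  open CommutativeRing R
  open import Algebra.Definitions.RawSemiring (Semiring.rawSemiring semiring) using (_^_)

  deltaTable-suc : ∀ {n j} → j ≤ n → deltaTable R (suc n) p σ a j ≡ deltaTable R n p σ a j
  deltaTable-suc {n} {j} j≤n with j ≤ᵇ n | ℕ.≤⇒≤ᵇ j≤n
  ... | true | _ = ≡.refl

  deltaTable-stable : ∀ {n j} → j ≤ n → deltaTable R n p σ a j ≡ δ R p σ a j
  deltaTable-stable {zero}  z≤n = ≡.refl
  deltaTable-stable {suc n} j≤1+n with ℕ.m≤n⇒m<n∨m≡n j≤1+n
  ... | inj₁ (s≤s j≤n) = ≡.trans (deltaTable-suc j≤n) (deltaTable-stable j≤n)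
  ... | inj₂ ≡.refl    = ≡.refl

  δ-suc : ∀ n → δ R p σ a (suc n) ≡
          a ^ (p ^ℕ suc n ∸ 1) - sum1 R n (λ j → deltaTable R n p σ a j * iter R σ j (a ^ (p ^ℕ (suc n ∸ j) ∸ 1)))
  δ-suc n with suc n ≤ᵇ n | ℕ.≤ᵇ⇒≤ (suc n) n
  ... | false | _     = ≡.refl
  ... | true  | 1+n≤n = ⊥-elim (ℕ.n≮n n (1+n≤n _))

module FrobeniusLift {c ℓ} (R : CommutativeRing c ℓ) (p : ℕ) where
  open CommutativeRing R
  open RingMorphisms rawRing rawRing using (IsRingHomomorphism)
  open import Algebra.Definitions.RawSemiring (Semiring.rawSemiring semiring) using (_^_; _×_)
  open import Algebra.Properties.Semiring.Exp semiring using (^-assocʳ)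
  open import Algebra.Properties.Semiring.Mult semiring using (×1-homo-*)
  open Congruences R
  open Endomorphisms R

  infix 8 p^_

  p^_ : ℕ → Carrier
  p^ k = (p ^ℕ k) × 1#

  p^-+ : ∀ m n → p^ (m ℕ.+ n) ≈ p^ m * p^ n
  p^-+ m n = trans (reflexive (≡.cong (_× 1#) (ℕ.^-distribˡ-+-* p m n))) (×1-homo-* (p ^ℕ m) (p ^ℕ n))

  p^-suc : ∀ k → p^ suc k ≈ p × 1# * p^ k
  p^-suc k = ×1-homo-* p (p ^ℕ k)

  p^-∣ : ∀ {m n} → m ≤ n → p^ m ∣ p^ n
  p^-∣ {m} {n} m≤n = p^ (n ∸ m) , trans (reflexive (≡.cong p^_ (≡.sym (ℕ.m+[n∸m]≡n m≤n)))) (p^-+ m (n ∸ m))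

  ^p^-lift : ∀ k {x y} → x ≈ y mod p × 1# → x ^ (p ^ℕ k) ≈ y ^ (p ^ℕ k) mod p^ suc k
  ^p^-lift zero    x≈y = mod-weaken (∣-reflexive (reflexive (≡.cong (_× 1#) (ℕ.*-identityʳ p))))
                                    (mod-*-cong x≈y (≈⇒≈-mod refl))
  ^p^-lift (suc k) {x} {y} x≈y =
    mod-trans (≈⇒≈-mod (sym (^p^-suc x))) (mod-trans lifted (≈⇒≈-mod (^p^-suc y)))
    where
    ^p^-suc : ∀ z → (z ^ (p ^ℕ k)) ^ p ≈ z ^ (p ^ℕ suc k)
    ^p^-suc z = trans (^-assocʳ z (p ^ℕ k) p) (reflexive (≡.cong (z ^_) (ℕ.*-comm (p ^ℕ k) p)))
    IH : x ^ (p ^ℕ k) ≈ y ^ (p ^ℕ k) mod p × 1# * p^ k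
    IH = mod-weaken (∣-reflexive (sym (p^-suc k))) (^p^-lift k x≈y)
    lifted : (x ^ (p ^ℕ k)) ^ p ≈ (y ^ (p ^ℕ k)) ^ p mod p^ suc (suc k)
    lifted = mod-weaken (∣-reflexive (trans (p^-suc (suc k)) (*-congˡ (p^-suc k)))) (^-lift p IH)

  module _ {σ} (σ-hom : IsRingHomomorphism σ) (σ-frob : ∀ x → p × 1# ∣ σ x - x ^ p) where

    σ-mod : ∀ k {x y} → x ≈ y mod p^ k → σ x ≈ σ y mod p^ k
    σ-mod k = mod-weaken (∣-reflexive (sym (×1-homo σ-hom (p ^ℕ k)))) ∘ mod-homo σ-hom

    σ-^p^ : ∀ k x → σ (x ^ (p ^ℕ k)) ≈ x ^ (p ^ℕ suc k) mod p^ suc k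
    σ-^p^ k x = mod-trans (≈⇒≈-mod (^-homo σ-hom x (p ^ℕ k)))
                          (mod-trans (^p^-lift k (∣-⇒mod (σ-frob x))) (≈⇒≈-mod (^-assocʳ x p (p ^ℕ k))))

    iter-^p^ : ∀ i k x → iter R σ i (x ^ (p ^ℕ k)) ≈ x ^ (p ^ℕ (i ℕ.+ k)) mod p^ suc k
    iter-^p^ zero    k x = ≈⇒≈-mod refl
    iter-^p^ (suc i) k x = mod-trans (σ-mod (suc k) (iter-^p^ i k x))
                                     (mod-weaken (p^-∣ (s≤s (ℕ.m≤n+m k i))) (σ-^p^ (i ℕ.+ k) x))

module DeltaDivisibility {c ℓ} (R : CommutativeRing c ℓ) (p : ℕ) .{{_ : NonZero p}}
  {σ : CommutativeRing.Carrier R → CommutativeRing.Carrier R}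
  (σ-hom : RingMorphisms.IsRingHomomorphism (CommutativeRing.rawRing R) (CommutativeRing.rawRing R) σ)
  (σ-frob : ∀ x → InMultiples R p (CommutativeRing._-_ R (σ x) (pow R x p)))
  (a : CommutativeRing.Carrier R) where
  open CommutativeRing R
  open import Algebra.Definitions.RawSemiring (Semiring.rawSemiring semiring) using (_^_)
  open import Algebra.Properties.AbelianGroup +-abelianGroup using (xyx⁻¹≈y)
  open import Relation.Binary.Reasoning.Setoid setoid
  open Congruences R
  open Endomorphisms R
  open FrobeniusLift R p
  open DeltaTable R p σ a

  δₐ : ℕ → Carrier
  δₐ = δ R p σ a

  δ-recursion : ∀ n → sum1 R (suc n) (λ i → δₐ i * iter R σ i (a ^ (p ^ℕ (suc n ∸ i) ∸ 1)))
                      ≈ a ^ (p ^ℕ suc n ∸ 1)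
  δ-recursion n = begin
    S + δₐ (suc n) * iter R σ (suc n) (a ^ (p ^ℕ (n ∸ n) ∸ 1))
      ≡⟨ ≡.cong (λ t → S + δₐ (suc n) * iter R σ (suc n) (a ^ (p ^ℕ t ∸ 1))) (ℕ.n∸n≡0 n) ⟩
    S + δₐ (suc n) * iter R σ (suc n) 1# ≈⟨ +-congˡ (*-congˡ 1#-homo) ⟩
    S + δₐ (suc n) * 1#                 ≈⟨ +-congˡ (*-identityʳ _) ⟩
    S + δₐ (suc n)                      ≡⟨ ≡.cong (S +_) (δ-suc n) ⟩
    S + (A - S′)                        ≈⟨ +-congˡ (+-congˡ (-‿cong S≈S′)) ⟨
    S + (A - S)                         ≈⟨ +-assoc S A (- S) ⟨
    S + A - S                           ≈⟨ xyx⁻¹≈y S A ⟩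
    A                                   ∎
    where
    open RingMorphisms.IsRingHomomorphism (iter-isRingHomomorphism σ-hom (suc n)) using (1#-homo)
    A = a ^ (p ^ℕ suc n ∸ 1)
    S = sum1 R n (λ j → δₐ j * iter R σ j (a ^ (p ^ℕ (suc n ∸ j) ∸ 1)))
    S′ = sum1 R n (λ j → deltaTable R n p σ a j * iter R σ j (a ^ (p ^ℕ (suc n ∸ j) ∸ 1)))
    S≈S′ : S ≈ S′
    S≈S′ = sum1-cong n (λ j<n → *-congʳ (reflexive (≡.sym (deltaTable-stable j<n))))

  δ-sum : ℕ → ℕ → Carrier
  δ-sum m s = sum1 R s (λ i → δₐ i * iter R σ i (a ^ (m ℕ.* p ^ℕ (s ∸ i) ∸ 1)))

  δ-suc-≈ : ∀ s → δₐ (suc s) ≈ a ^ (p ℕ.* p ^ℕ s ∸ 1) - δ-sum p s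
  δ-suc-≈ s = trans (reflexive (δ-suc s)) (+-congˡ (-‿cong (sum1-cong s (λ {i} i<s →
    *-cong (reflexive (deltaTable-stable i<s))
           (reflexive (≡.cong (λ t → iter R σ (suc i) (a ^ (p ^ℕ t ∸ 1))) (ℕ.+-∸-assoc 1 i<s)))))))

  δ-summand : ∀ {m s i} → 1 ≤ m → i < s → p^ i ∣ δₐ (suc i) →
              δₐ (suc i) * iter R σ (suc i) (a ^ (m ℕ.* p ^ℕ (s ∸ suc i) ∸ 1))
              ≈ δₐ (suc i) * iter R σ (suc i) (a ^ (p ^ℕ (s ∸ suc i) ∸ 1)) * (a ^ (m ∸ 1)) ^ (p ^ℕ s)
              mod p^ s
  δ-summand {m} {s} {i} 1≤m i<s p^i∣δ =
    mod-trans (≈⇒≈-mod (*-congˡ iter-split))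
      (mod-trans (mod-weaken (∣-reflexive modulus) (mod-*-scale p^i∣δ (mod-*-cong (≈⇒≈-mod refl) iter-X^q)))
                 (≈⇒≈-mod (sym (*-assoc _ _ _))))
    where
    open RingMorphisms.IsRingHomomorphism (iter-isRingHomomorphism σ-hom (suc i)) using (⟦⟧-cong; *-homo)
    q = p ^ℕ (s ∸ suc i)
    X = a ^ (m ∸ 1)
    iter-split : iter R σ (suc i) (a ^ (m ℕ.* q ∸ 1)) ≈ iter R σ (suc i) (a ^ (q ∸ 1)) * iter R σ (suc i) (X ^ q)
    iter-split = trans (⟦⟧-cong (^-split a 1≤m (ℕ.m^n>0 p (s ∸ suc i)))) (*-homo _ _)
    iter-X^q : iter R σ (suc i) (X ^ q) ≈ X ^ (p ^ℕ s) mod p^ suc (s ∸ suc i)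
    iter-X^q = mod-trans (iter-^p^ σ-hom σ-frob (suc i) (s ∸ suc i) X)
                         (≈⇒≈-mod (reflexive (≡.cong (λ t → X ^ (p ^ℕ t)) (ℕ.m+[n∸m]≡n i<s))))
    modulus : p^ s ≈ p^ i * p^ suc (s ∸ suc i)
    modulus = trans (reflexive (≡.cong p^_ (≡.sym (≡.trans (ℕ.+-suc i (s ∸ suc i)) (ℕ.m+[n∸m]≡n i<s)))))
                    (p^-+ i (suc (s ∸ suc i)))

  δ-sum-congruence : ∀ m n → 1 ≤ m → (∀ {i} → i < suc n → p^ i ∣ δₐ (suc i)) →
                     δ-sum m (suc n) ≈ a ^ (m ℕ.* p ^ℕ suc n ∸ 1) mod p^ suc n
  δ-sum-congruence m n 1≤m δ-div =
    mod-trans (sum1-cong-mod s (λ i<s → δ-summand 1≤m i<s (δ-div i<s))) (≈⇒≈-mod (begin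
      sum1 R s (λ i → δₐ i * cofactor i * X^p^s) ≈⟨ sum1-*-distribʳ s (λ i → δₐ i * cofactor i) X^p^s ⟨
      sum1 R s (λ i → δₐ i * cofactor i) * X^p^s ≈⟨ *-congʳ (δ-recursion n) ⟩
      a ^ (p ^ℕ s ∸ 1) * X^p^s                    ≈⟨ ^-split a 1≤m (ℕ.m^n>0 p s) ⟨
      a ^ (m ℕ.* p ^ℕ s ∸ 1)                      ∎))
    where
    s = suc n
    X^p^s = (a ^ (m ∸ 1)) ^ (p ^ℕ s)
    cofactor : ℕ → Carrier
    cofactor i = iter R σ i (a ^ (p ^ℕ (s ∸ i) ∸ 1))

  δ-divisible : ∀ s → p^ s ∣ δₐ (suc s)
  δ-divisible = <-rec _ divisible
    where
    divisible : ∀ s → (∀ {i} → i < s → p^ i ∣ δₐ (suc i)) → p^ s ∣ δₐ (suc s)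
    divisible zero    _     = 1∣ δₐ 1
    divisible (suc n) δ-div = ∣-respʳ (sym (δ-suc-≈ (suc n)))
                                      (mod⇒∣- (mod-sym (δ-sum-congruence p n (ℕ.>-nonZero⁻¹ p) δ-div)))

open import Data.Nat.Base using (_*_)
open import Data.Product.Base using (_×_)

lemma1 : ∀ {c ℓ} (R : CommutativeRing c ℓ) (p : ℕ) → Prime p →
         (σ : CommutativeRing.Carrier R → CommutativeRing.Carrier R) →
         RingMorphisms.IsRingHomomorphism (CommutativeRing.rawRing R) (CommutativeRing.rawRing R) σ →
         (∀ x → InMultiples R p (CommutativeRing._-_ R (σ x) (pow R x p))) →
         ∀ a →
         (∀ s → 1 ≤ s → InMultiples R (p ^ℕ (s ∸ 1)) (δ R p σ a s))
         × (∀ m s → 1 ≤ m → 1 ≤ s →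
              InMultiples R (p ^ℕ s)
                (CommutativeRing._-_ R (pow R a (m * p ^ℕ s ∸ 1))
                   (sum1 R s (λ i → CommutativeRing._*_ R (δ R p σ a i)
                                      (iter R σ i (pow R a (m * p ^ℕ (s ∸ i) ∸ 1)))))))
lemma1 R p p-prime σ σ-hom σ-frob a = δ-bound , δ-sum-bound
  where
  open Congruences R
  open DeltaDivisibility R p {{prime⇒nonZero p-prime}} σ-hom σ-frob a
  δ-bound : ∀ s → 1 ≤ s → InMultiples R (p ^ℕ (s ∸ 1)) (δ R p σ a s)
  δ-bound (suc s) _ = δ-divisible s
  δ-sum-bound : ∀ m s → 1 ≤ m → 1 ≤ s → InMultiples R (p ^ℕ s) (CommutativeRing._-_ R (pow R a (m * p ^ℕ s ∸ 1)) (δ-sum m s))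
  δ-sum-bound m (suc n) 1≤m _ = mod⇒∣- (mod-sym (δ-sum-congruence m n 1≤m (λ {i} _ → δ-divisible i)))
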